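{- Let $r\ge 2$ and $y\ge 1$ be integers. There exists $N=N(r,y)$ such that the following holds. Let $A,B_1,\dots,B_y$ be pairwise disjoint vertex sets, each of size $n>N$, and consider an $r$-coloring of the edges of the complete bipartite graph between $A$ and each $B_i$. Then there exist a set $W\subseteq A$ with $|W|=n^{2^{ -y}}$ and colors $c_1,\dots,c_y\in[r]$ such that for every $1\le i\le y$ and every subset $X\subseteq W$ of size $\frac18\log_r n$ we have $|N^{c_i}_{B_i}(X)|\ge\sqrt n$.
   Context: $N^{c}_{B}(X)$ denotes the set of vertices of $B$ joined to every vertex of $X$ by an edge of color $c$ (the common $c$-colored neighborhood of $X$ in $B$). Non-integral set sizes are understood as rounded to integers. -}

module Defs where

open import Data.Nat using (ℕ; suc; _≤_; _<_; _^_)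
open import Data.Product using (_×_)
open import Data.Fin using (Fin)
open import Data.Fin.Properties using (all?) renaming (_≟_ to _≟ᶠ_)
open import Data.Fin.Subset using (Subset)
open import Data.Fin.Subset.Properties using (_∈?_)
open import Data.Vec using (tabulate)
open import Relation.Nullary.Decidable using (does; _→-dec_)

-- Common c-coloured neighbourhood N^c_B(X):
-- col a b is the colour of the edge between a ∈ A = Fin n and b ∈ B = Fin n.
-- Result: the set of b ∈ B such that col a b ≡ c for every a ∈ X.
commonNbhd : ∀ {n r} → (Fin n → Fin n → Fin r) → Fin r → Subset n → Subset n
commonNbhd col c X = tabulate λ b → does (all? λ a → (a ∈? X) →-dec (col a b ≟ᶠ c))

IsFloorLog : ℕ → ℕ → ℕ → Set
IsFloorLog r n k = r ^ k ≤ n × n < r ^ suc k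

IsFloorRoot : ℕ → ℕ → ℕ → Set
IsFloorRoot m n w = w ^ m ≤ n × n < suc w ^ m

-- Dependent random choice, once for each B_i.  Let the current set A' ⊆ A have m = ⌊n^(1/v)⌋
-- elements and t = ⌊k/8⌋.  Every vertex of A' has at least n/r edges of some colour into B, so
-- for some colour c at least m/r vertices of A' are rich: they have at least n/r edges of colour c.
-- For an s-tuple T of vertices of B let W_T be the set of rich vertices c-joined to all of T.
-- Summing over T, the sizes of the W_T add up to at least m n^s / r^(s+1).  A t-set X ⊆ A' whose
-- common c-neighbourhood N satisfies |N|^2 < n lies in at most |N|^s ≤ n^(s/2) of the W_T, and
-- there are at most m^t such X.  For s = 2(⌊t/v⌋ + 2) these bounds give a tuple T for which W_T
-- has at least ⌊n^(1/2v)⌋ elements and contains no such X.  Shrinking W_T to exactly that size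
-- and recursing on it for the next B_i doubles v each time, so after y rounds v = 2^y.

module Submission where

open import Defs
open import Data.Bool using (Bool; true; false; _∧_)
open import Data.Bool.Properties using (∧-zeroʳ)
open import Data.Fin using (Fin; zero; suc)
open import Data.Fin.Properties using () renaming (_≟_ to _≟ᶠ_; all? to allFin?)
open import Data.Fin.Subset using (Subset; inside; outside; _⊆_; _∈_; ∣_∣; ⊥; ⊤)
open import Data.Fin.Subset.Properties using (_∈?_; _⊆?_; s⊆s; ⊆-min; ⊆-refl; ⊆-trans; ∣⊥∣≡0; ∣⊤∣≡n; p⊆q⇒∣p∣≤∣q∣)
open import Data.Nat
open import Data.Nat.DivMod
open import Data.Nat.Properties
open import Algebra.Properties.CommutativeSemigroup *-commutativeSemigroup using (x∙yz≈y∙xz) renaming (interchange to *-interchange)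
open import Algebra.Properties.CommutativeSemigroup +-commutativeSemigroup using () renaming (interchange to +-interchange)
open import Algebra.Properties.Semiring.Sum +-*-semiring using (sum; sum-cong-≗; ∑-distrib-+)
open import Data.Nat.Tactic.RingSolver using (solve-∀)
open import Data.Product using (_,_; _×_; ∃-syntax; Σ-syntax; proj₁; proj₂; map₂)
open import Data.Vec using (Vec; []; _∷_; tabulate)
open import Data.Vec.Functional using () renaming (_∷_ to _∷ᶠ_)
open import Data.Vec.Properties using (lookup∘tabulate; []=⇒lookup; lookup⇒[]=)
open import Data.Vec.Relation.Unary.All as All using (All; []; _∷_; all?)
open import Function using (_∘_)
open import Relation.Binary.PropositionalEquality
open import Relation.Nullary using (Dec; does; yes; no; _×-dec_; _→-dec_; contradiction)
open import Relation.Nullary.Decidable using (dec-true)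
open import Relation.Unary using (Pred; Decidable)

-- Finite sums

𝟙 : Bool → ℕ
𝟙 true  = 1
𝟙 false = 0

𝟙-∧ : ∀ x y → 𝟙 (x ∧ y) ≡ 𝟙 x * 𝟙 y
𝟙-∧ true  y = sym (+-identityʳ (𝟙 y))
𝟙-∧ false y = refl

𝟙-*-mono : ∀ {ℓ} {P : Set ℓ} (P? : Dec P) {x y} → (P → x ≤ y) → 𝟙 (does P?) * x ≤ 𝟙 (does P?) * y
𝟙-*-mono (yes p) x≤y = *-monoʳ-≤ 1 (x≤y p)
𝟙-*-mono (no _)  _   = z≤n

𝟙-*-≤ : ∀ {ℓ} {P : Set ℓ} (P? : Dec P) {x y} → (P → x ≤ y) → 𝟙 (does P?) * x ≤ y
𝟙-*-≤ (yes p) x≤y = ≤-trans (≤-reflexive (*-identityˡ _)) (x≤y p)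
𝟙-*-≤ (no _)  _   = z≤n

record IsAdditive {D : Set} (Φ : (D → ℕ) → ℕ) : Set where
  field
    cong-≗ : ∀ {f g} → f ≗ g → Φ f ≡ Φ g
    +-hom  : ∀ f g → Φ (λ x → f x + g x) ≡ Φ f + Φ g

  0-hom : Φ (λ _ → 0) ≡ 0
  0-hom = sym (+-cancelˡ-≡ (Φ (λ _ → 0)) 0 _ (trans (+-identityʳ _) (+-hom _ _)))

  *-homˡ : ∀ k f → Φ (λ x → k * f x) ≡ k * Φ f
  *-homˡ zero    f = 0-hom
  *-homˡ (suc k) f = trans (+-hom f _) (cong (Φ f +_) (*-homˡ k f))

  *-homʳ : ∀ k f → Φ (λ x → f x * k) ≡ Φ f * k
  *-homʳ k f = trans (cong-≗ (λ x → *-comm (f x) k)) (trans (*-homˡ k f) (*-comm k (Φ f)))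

  mono : ∀ {f g} → (∀ x → f x ≤ g x) → Φ f ≤ Φ g
  mono {f} {g} f≤g = begin
    Φ f                                ≤⟨ m≤m+n (Φ f) _ ⟩
    Φ f + Φ (λ x → g x ∸ f x)          ≡⟨ +-hom f _ ⟨
    Φ (λ x → f x + (g x ∸ f x))        ≡⟨ cong-≗ (λ x → m+[n∸m]≡n (f≤g x)) ⟩
    Φ g                                ∎
    where open ≤-Reasoning

record Summation (A : Set) : Set₁ where
  field
    ∑          : (A → ℕ) → ℕ
    isAdditive : IsAdditive ∑
    ∑-comm     : ∀ {D} {Φ : (D → ℕ) → ℕ} → IsAdditive Φ → (f : A → D → ℕ) →
                 ∑ (λ a → Φ (f a)) ≡ Φ (λ d → ∑ (λ a → f a d))
    averaging  : ∀ f g → ∑ f < ∑ g → ∃[ a ] f a < g a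
    term≤∑     : ∀ f a → f a ≤ ∑ f

  open IsAdditive isAdditive public

  size : ℕ
  size = ∑ (λ _ → 1)

  ∑-const : ∀ k → ∑ (λ _ → k) ≡ size * k
  ∑-const k = trans (cong-≗ (λ _ → sym (*-identityˡ k))) (*-homʳ k (λ _ → 1))

  ≤-averaging : 0 < size → ∀ f g → ∑ f ≤ ∑ g → ∃[ a ] f a ≤ g a
  ≤-averaging size>0 f g ∑f≤∑g = map₂ s≤s⁻¹ (averaging f (λ a → 1 + g a) (begin-strict
    ∑ f               <⟨ m<n+m (∑ f) size>0 ⟩
    size + ∑ f        ≤⟨ +-monoʳ-≤ size ∑f≤∑g ⟩
    size + ∑ g        ≡⟨ +-hom (λ _ → 1) g ⟨
    ∑ (λ a → 1 + g a) ∎))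
    where open ≤-Reasoning

finSum : ∀ n → Summation (Fin n)
finSum n = record
  { ∑          = sum
  ; isAdditive = record { cong-≗ = sum-cong-≗ ; +-hom = ∑-distrib-+ }
  ; ∑-comm     = comm n
  ; averaging  = avg n
  ; term≤∑     = term n
  }
  where
  comm : ∀ n {D} {Φ : (D → ℕ) → ℕ} → IsAdditive Φ → (f : Fin n → D → ℕ) →
         sum (λ i → Φ (f i)) ≡ Φ (λ d → sum (λ i → f i d))
  comm zero    Φ-add f = sym (IsAdditive.0-hom Φ-add)
  comm (suc n) {Φ = Φ} Φ-add f = trans (cong (Φ (f zero) +_) (comm n Φ-add (λ i → f (suc i))))
                                       (sym (IsAdditive.+-hom Φ-add (f zero) _))
  avg : ∀ n (f g : Fin n → ℕ) → sum f < sum g → ∃[ i ] f i < g i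
  avg (suc n) f g ∑f<∑g with f zero <? g zero
  ... | yes f0<g0 = zero , f0<g0
  ... | no  f0≮g0 with avg n (λ i → f (suc i)) (λ i → g (suc i))
                          (+-cancelˡ-< (f zero) _ _ (<-≤-trans ∑f<∑g (+-monoˡ-≤ _ (≮⇒≥ f0≮g0))))
  ...   | i , fi<gi = suc i , fi<gi
  term : ∀ n (f : Fin n → ℕ) i → f i ≤ sum f
  term (suc n) f zero    = m≤m+n (f zero) _
  term (suc n) f (suc i) = ≤-trans (term n (λ i → f (suc i)) i) (m≤n+m _ (f zero))

size-finSum : ∀ n → Summation.size (finSum n) ≡ n
size-finSum zero    = refl
size-finSum (suc n) = cong suc (size-finSum n)

fin-pigeonhole : ∀ {r k} (f : Fin (suc r) → ℕ) → k ≤ sum f → ∃[ c ] k ≤ suc r * f c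
fin-pigeonhole {r} {k} f k≤∑f = Colours.≤-averaging size>0 (λ _ → k) (λ c → suc r * f c) (begin
  Colours.∑ (λ _ → k)           ≡⟨ Colours.∑-const k ⟩
  Colours.size * k              ≡⟨ cong (_* k) (size-finSum (suc r)) ⟩
  suc r * k                     ≤⟨ *-monoʳ-≤ (suc r) k≤∑f ⟩
  suc r * Colours.∑ f           ≡⟨ Colours.*-homˡ (suc r) f ⟨
  Colours.∑ (λ c → suc r * f c) ∎)
  where
  open ≤-Reasoning
  module Colours = Summation (finSum (suc r))
  size>0 : 0 < Colours.size
  size>0 = subst (0 <_) (sym (size-finSum (suc r))) z<s

∑𝟙≟≡1 : ∀ {r} (x : Fin r) → sum (λ c → 𝟙 (does (x ≟ᶠ c))) ≡ 1
∑𝟙≟≡1 {suc r} zero    = cong suc (Summation.0-hom (finSum r))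
∑𝟙≟≡1         (suc x) = ∑𝟙≟≡1 x

boolSum : Summation Bool
boolSum = record
  { ∑          = λ f → f false + f true
  ; isAdditive = record
    { cong-≗ = λ f≗g → cong₂ _+_ (f≗g false) (f≗g true)
    ; +-hom  = λ f g → +-interchange (f false) (g false) (f true) (g true) }
  ; ∑-comm     = λ Φ-add f → sym (IsAdditive.+-hom Φ-add (f false) (f true))
  ; averaging  = avg
  ; term≤∑     = term
  }
  where
  avg : ∀ f g → f false + f true < g false + g true → ∃[ b ] f b < g b
  avg f g ∑f<∑g with f false <? g false
  ... | yes ff<gf = false , ff<gf
  ... | no  ff≮gf = true , +-cancelˡ-< (f false) _ _ (<-≤-trans ∑f<∑g (+-monoˡ-≤ _ (≮⇒≥ ff≮gf)))
  term : ∀ f b → f b ≤ f false + f true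
  term f false = m≤m+n (f false) (f true)
  term f true  = m≤n+m (f true) (f false)

module _ {A : Set} (S : Summation A) where
  private module S = Summation S

  ∑ⱽ : ∀ s → (Vec A s → ℕ) → ℕ
  ∑ⱽ zero    f = f []
  ∑ⱽ (suc s) f = S.∑ (λ a → ∑ⱽ s (λ as → f (a ∷ as)))

  vecSum : ∀ s → Summation (Vec A s)
  vecSum s = record
    { ∑          = ∑ⱽ s
    ; isAdditive = record { cong-≗ = cong-≗ s ; +-hom = +-hom s }
    ; ∑-comm     = comm s
    ; averaging  = avg s
    ; term≤∑     = term s
    }
    where
    cong-≗ : ∀ s {f g} → f ≗ g → ∑ⱽ s f ≡ ∑ⱽ s g
    cong-≗ zero    f≗g = f≗g []
    cong-≗ (suc s) f≗g = S.cong-≗ (λ a → cong-≗ s (λ as → f≗g (a ∷ as)))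
    +-hom : ∀ s f g → ∑ⱽ s (λ x → f x + g x) ≡ ∑ⱽ s f + ∑ⱽ s g
    +-hom zero    f g = refl
    +-hom (suc s) f g = trans (S.cong-≗ (λ a → +-hom s _ _)) (S.+-hom _ _)
    comm : ∀ s {D} {Φ : (D → ℕ) → ℕ} → IsAdditive Φ → (f : Vec A s → D → ℕ) →
           ∑ⱽ s (λ as → Φ (f as)) ≡ Φ (λ d → ∑ⱽ s (λ as → f as d))
    comm zero    Φ-add f = refl
    comm (suc s) Φ-add f = trans (S.cong-≗ (λ a → comm s Φ-add (λ as → f (a ∷ as))))
                                 (S.∑-comm Φ-add (λ a d → ∑ⱽ s (λ as → f (a ∷ as) d)))
    avg : ∀ s f g → ∑ⱽ s f < ∑ⱽ s g → ∃[ as ] f as < g as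
    avg zero    f g f[]<g[] = [] , f[]<g[]
    avg (suc s) f g ∑f<∑g with S.averaging _ _ ∑f<∑g
    ... | a , ∑fa<∑ga with avg s _ _ ∑fa<∑ga
    ...   | as , f<g = a ∷ as , f<g
    term : ∀ s f as → f as ≤ ∑ⱽ s f
    term zero    f []       = ≤-refl
    term (suc s) f (a ∷ as) = ≤-trans (term s (λ as → f (a ∷ as)) as) (S.term≤∑ _ a)

  size-vecSum : ∀ s → Summation.size (vecSum s) ≡ S.size ^ s
  size-vecSum zero    = refl
  size-vecSum (suc s) = begin
    S.∑ (λ _ → Summation.size (vecSum s)) ≡⟨ S.∑-const _ ⟩
    S.size * Summation.size (vecSum s)    ≡⟨ cong (S.size *_) (size-vecSum s) ⟩
    S.size ^ suc s                        ∎
    where open ≡-Reasoning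

  ∑ⱽ-all : ∀ {ℓ} {P : Pred A ℓ} (P? : Decidable P) s →
           ∑ⱽ s (λ as → 𝟙 (does (all? P? as))) ≡ S.∑ (λ a → 𝟙 (does (P? a))) ^ s
  ∑ⱽ-all P? zero    = refl
  ∑ⱽ-all P? (suc s) = begin
    S.∑ (λ a → ∑ⱽ s (λ as → 𝟙 (does (P? a) ∧ does (all? P? as))))
      ≡⟨ S.cong-≗ (λ a → Summation.cong-≗ (vecSum s) (λ as → 𝟙-∧ (does (P? a)) _)) ⟩
    S.∑ (λ a → ∑ⱽ s (λ as → 𝟙 (does (P? a)) * 𝟙 (does (all? P? as))))
      ≡⟨ S.cong-≗ (λ a → Summation.*-homˡ (vecSum s) (𝟙 (does (P? a))) _) ⟩
    S.∑ (λ a → 𝟙 (does (P? a)) * ∑ⱽ s (λ as → 𝟙 (does (all? P? as))))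
      ≡⟨ S.cong-≗ (λ a → cong (𝟙 (does (P? a)) *_) (∑ⱽ-all P? s)) ⟩
    S.∑ (λ a → 𝟙 (does (P? a)) * S.∑ (λ a → 𝟙 (does (P? a))) ^ s)
      ≡⟨ S.*-homʳ _ _ ⟩
    S.∑ (λ a → 𝟙 (does (P? a))) ^ suc s
      ∎
    where open ≡-Reasoning

-- Counting subsets

subsetSum : ∀ n → Summation (Subset n)
subsetSum = vecSum boolSum

∑ₛ : ∀ n → (Subset n → ℕ) → ℕ
∑ₛ n = Summation.∑ (subsetSum n)

∣p∣≡∑∈ : ∀ {n} (p : Subset n) → ∣ p ∣ ≡ sum (λ x → 𝟙 (does (x ∈? p)))
∣p∣≡∑∈ []            = refl
∣p∣≡∑∈ (outside ∷ p) = ∣p∣≡∑∈ p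
∣p∣≡∑∈ (inside ∷ p)  = cong suc (∣p∣≡∑∈ p)

∣tabulate∣ : ∀ {n} (f : Fin n → Bool) → ∣ tabulate f ∣ ≡ sum (𝟙 ∘ f)
∣tabulate∣ {zero}  f = refl
∣tabulate∣ {suc n} f with f zero
... | true  = cong suc (∣tabulate∣ (f ∘ suc))
... | false = ∣tabulate∣ (f ∘ suc)

#sized-subsets : ∀ {n} → Subset n → ℕ → ℕ
#sized-subsets {n} p t = ∑ₛ n (λ X → 𝟙 (does (X ⊆? p) ∧ does (∣ X ∣ ≟ t)))

#sized-subsets≤ : ∀ {n} (p : Subset n) t → #sized-subsets p t ≤ ∣ p ∣ ^ t
#sized-subsets≤ []            zero    = ≤-refl
#sized-subsets≤ []            (suc t) = z≤n
#sized-subsets≤ {suc n} (outside ∷ p) t = begin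
  #sized-subsets p t + ∑ₛ n (λ _ → 0) ≡⟨ cong (#sized-subsets p t +_) (Summation.0-hom (subsetSum n)) ⟩
  #sized-subsets p t + 0              ≡⟨ +-identityʳ _ ⟩
  #sized-subsets p t                  ≤⟨ #sized-subsets≤ p t ⟩
  ∣ p ∣ ^ t                           ∎
  where open ≤-Reasoning
#sized-subsets≤ {suc n} (inside ∷ p) zero = begin
  #sized-subsets p 0 + ∑ₛ n (λ X → 𝟙 (does (X ⊆? p) ∧ false))
    ≡⟨ cong (#sized-subsets p 0 +_) (trans (Summation.cong-≗ (subsetSum n) (λ X → cong 𝟙 (∧-zeroʳ _)))
                                           (Summation.0-hom (subsetSum n))) ⟩
  #sized-subsets p 0 + 0
    ≤⟨ +-monoˡ-≤ 0 (#sized-subsets≤ p 0) ⟩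
  1 + 0 ∎
  where open ≤-Reasoning
#sized-subsets≤ (inside ∷ p) (suc t) = begin
  #sized-subsets p (suc t) + #sized-subsets p t ≤⟨ +-mono-≤ (#sized-subsets≤ p (suc t)) (#sized-subsets≤ p t) ⟩
  m * m ^ t + m ^ t                            ≡⟨ +-comm (m * m ^ t) _ ⟩
  m ^ t + m * m ^ t                            ≤⟨ +-mono-≤ (^-monoˡ-≤ t (n≤1+n m)) (*-monoʳ-≤ m (^-monoˡ-≤ t (n≤1+n m))) ⟩
  suc m ^ suc t                                ∎
  where
  open ≤-Reasoning
  m = ∣ p ∣

⊆-of-size : ∀ {n} (p : Subset n) {w} → w ≤ ∣ p ∣ → ∃[ q ] q ⊆ p × ∣ q ∣ ≡ w
⊆-of-size []            z≤n = [] , (λ x∈[] → x∈[]) , refl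
⊆-of-size (outside ∷ p) w≤∣p∣ with ⊆-of-size p w≤∣p∣
... | q , q⊆p , ∣q∣≡w = outside ∷ q , s⊆s q⊆p , ∣q∣≡w
⊆-of-size {suc n} (inside ∷ p) {zero} _ = ⊥ , ⊆-min _ , ∣⊥∣≡0 (suc n)
⊆-of-size (inside ∷ p) {suc w} (s≤s w≤∣p∣) with ⊆-of-size p w≤∣p∣
... | q , q⊆p , ∣q∣≡w = inside ∷ q , s⊆s q⊆p , cong suc ∣q∣≡w

module _ {n ℓ} {P : Pred (Fin n) ℓ} (P? : Decidable P) {x : Fin n} where

  ∈-tabulate⁺ : P x → x ∈ tabulate (does ∘ P?)
  ∈-tabulate⁺ px = lookup⇒[]= x _ (trans (lookup∘tabulate (does ∘ P?) x) (dec-true (P? x) px))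

  ∈-tabulate⁻ : x ∈ tabulate (does ∘ P?) → P x
  ∈-tabulate⁻ x∈ with P? x | trans (sym (lookup∘tabulate (does ∘ P?) x)) ([]=⇒lookup x∈)
  ... | yes px | _ = px

all-∀ : ∀ {a b p q} {A : Set a} {B : Set b} {R : Pred A p} {Q : A → B → Set q} {s} (T : Vec B s) →
        (∀ x → R x → All (Q x) T) → All (λ y → ∀ x → R x → Q x y) T
all-∀ []      _   = []
all-∀ (y ∷ T) all = (λ x Rx → All.head (all x Rx)) ∷ all-∀ T (λ x Rx → All.tail (all x Rx))

-- Arithmetic

^-distribʳ-* : ∀ a b s → (a * b) ^ s ≡ a ^ s * b ^ s
^-distribʳ-* a b zero    = refl
^-distribʳ-* a b (suc s) = trans (cong (a * b *_) (^-distribʳ-* a b s)) (*-interchange a b (a ^ s) (b ^ s))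

^-+-self : ∀ x u → x ^ (u + u) ≡ (x ^ 2) ^ u
^-+-self x u = trans (cong (λ k → x ^ (u + k)) (sym (+-identityʳ u))) (sym (^-*-assoc x 2 u))

drc-inequality : ∀ m S₁ S₂ R M U w → 0 < R → m * (U * U) ≤ R * S₁ → S₂ ≤ M * U →
                 2 * R * w ≤ m → 2 * R * M ≤ U → m * S₂ + U * U * w ≤ S₁
drc-inequality m S₁ S₂ R@(suc _) M U w _ m*U²≤R*S₁ S₂≤M*U 2Rw≤m 2RM≤U = *-cancelˡ-≤ (2 * R) (begin
  2 * R * (m * S₂ + U * U * w)          ≡⟨ distribute m S₂ R U w ⟩
  m * (2 * R * S₂) + U * U * (2 * R * w) ≤⟨ +-mono-≤ (*-monoʳ-≤ m (*-monoʳ-≤ (2 * R) S₂≤M*U)) (*-monoʳ-≤ (U * U) 2Rw≤m) ⟩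
  m * (2 * R * (M * U)) + U * U * m     ≡⟨ cong (λ z → m * z + U * U * m) (*-assoc (2 * R) M U) ⟨
  m * (2 * R * M * U) + U * U * m       ≤⟨ +-monoˡ-≤ (U * U * m) (*-monoʳ-≤ m (*-monoˡ-≤ U 2RM≤U)) ⟩
  m * (U * U) + U * U * m               ≡⟨ double m U ⟩
  2 * (m * (U * U))                     ≤⟨ *-monoʳ-≤ 2 m*U²≤R*S₁ ⟩
  2 * (R * S₁)                          ≡⟨ *-assoc 2 R S₁ ⟨
  2 * R * S₁                            ∎)
  where
  open ≤-Reasoning
  distribute : ∀ m S₂ R U w → 2 * R * (m * S₂ + U * U * w) ≡ m * (2 * R * S₂) + U * U * (2 * R * w)
  distribute = solve-∀
  double : ∀ m U → m * (U * U) + U * U * m ≡ 2 * (m * (U * U))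
  double = solve-∀

^-cancelˡ-< : ∀ v {a b} → a ^ v < b ^ v → a < b
^-cancelˡ-< v {a} {b} a^v<b^v with a <? b
... | yes a<b = a<b
... | no  a≮b = contradiction a^v<b^v (≤⇒≯ (^-monoˡ-≤ v (≮⇒≥ a≮b)))

^-cancelˡ-≤ : ∀ v .{{_ : NonZero v}} {a b} → a ^ v ≤ b ^ v → a ≤ b
^-cancelˡ-≤ v {a} {b} a^v≤b^v with a ≤? b
... | yes a≤b = a≤b
... | no  a≰b = contradiction a^v≤b^v (<⇒≱ (^-monoˡ-< v (≰⇒> a≰b)))

^-cancelʳ-< : ∀ m .{{_ : NonZero m}} {a b} → m ^ a < m ^ b → a < b
^-cancelʳ-< m {a} {b} m^a<m^b with a <? b
... | yes a<b = a<b
... | no  a≮b = contradiction m^a<m^b (≤⇒≯ (^-monoʳ-≤ m (≮⇒≥ a≮b)))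

≤-floorRoot : ∀ {v n m a} → a ^ v ≤ n → IsFloorRoot v n m → a ≤ m
≤-floorRoot {v} a^v≤n (_ , n<[1+m]^v) = s≤s⁻¹ (^-cancelˡ-< v (≤-<-trans a^v≤n n<[1+m]^v))

floorRoot>0 : ∀ {v n m} → 0 < n → IsFloorRoot v n m → 0 < m
floorRoot>0 {v} {m = zero}  n>0 (_ , n<1^v) = contradiction (≤-trans n<1^v (≤-reflexive (^-zeroˡ v))) (≤⇒≯ n>0)
floorRoot>0             {m = suc _} _ _ = z<s

floorRoot≤ : ∀ {v n m} .{{_ : NonZero v}} → IsFloorRoot v n m → m ≤ n
floorRoot≤ {v} {m = zero}  _            = z≤n
floorRoot≤ {v} {m = suc m} (m^v≤n , _) = begin
  suc m      ≡⟨ *-identityʳ (suc m) ⟨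
  suc m ^ 1  ≤⟨ ^-monoʳ-≤ (suc m) (>-nonZero⁻¹ v) ⟩
  suc m ^ v  ≤⟨ m^v≤n ⟩
  _          ∎
  where open ≤-Reasoning

t≤v*suc[t/v] : ∀ t v .{{_ : NonZero v}} → t ≤ v * suc (t / v)
t≤v*suc[t/v] t v = begin
  t                     ≡⟨ m≡m%n+[m/n]*n t v ⟩
  t % v + t / v * v     ≤⟨ +-monoˡ-≤ (t / v * v) (<⇒≤ (m%n<n t v)) ⟩
  suc (t / v) * v       ≡⟨ *-comm (suc (t / v)) v ⟩
  v * suc (t / v)       ∎
  where open ≤-Reasoning

exponent-bound : ∀ q v t → q * v ≤ t → 3 * v ≤ t → suc (suc ((2 + q) + (2 + q))) * (2 * v) ≤ 8 * t
exponent-bound q v t q*v≤t 3v≤t = begin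
  suc (suc ((2 + q) + (2 + q))) * (2 * v) ≡⟨ expand q v ⟩
  4 * (q * v) + 4 * (3 * v)               ≤⟨ +-mono-≤ (*-monoʳ-≤ 4 q*v≤t) (*-monoʳ-≤ 4 3v≤t) ⟩
  4 * t + 4 * t                           ≡⟨ double t ⟩
  8 * t                                   ∎
  where
  open ≤-Reasoning
  expand : ∀ q v → suc (suc ((2 + q) + (2 + q))) * (2 * v) ≡ 4 * (q * v) + 4 * (3 * v)
  expand = solve-∀
  double : ∀ t → 4 * t + 4 * t ≡ 8 * t
  double = solve-∀

-- With P = 2 r^(2u+1) and u = ⌊t/v⌋ + 2 one has (P^2)^v ≤ r^(8t) ≤ n, so P^2 ≤ m and P w ≤ m;
-- and m^t ≤ n^(u-1) because t ≤ v (u - 1).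
drc-conditions : ∀ {n r v m w t} .{{_ : NonZero v}} → 0 < n → 2 ≤ r →
  IsFloorRoot v n m → IsFloorRoot (2 * v) n w → r ^ (8 * t) ≤ n → 3 * v ≤ t →
  ∃[ u ] 2 * r ^ suc (u + u) * w ≤ m × 2 * r ^ suc (u + u) * m ^ t ≤ n ^ u
drc-conditions {n} {r} {v} {m} {w} {t} n>0 2≤r m-root w-root r^8t≤n 3v≤t = u , P*w≤m , P*m^t≤n^u
  where
  open ≤-Reasoning
  instance
    r≢0 : NonZero r
    r≢0 = >-nonZero (≤-trans (s≤s z≤n) 2≤r)
    m≢0 : NonZero m
    m≢0 = >-nonZero (floorRoot>0 {v} n>0 m-root)
    w≢0 : NonZero w
    w≢0 = >-nonZero (floorRoot>0 {2 * v} n>0 w-root)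
  q = t / v
  u = 2 + q
  E = suc (suc (u + u))
  P = 2 * r ^ suc (u + u)
  P²≤m : P ^ 2 ≤ m
  P²≤m = ≤-floorRoot {v} (begin
    (P ^ 2) ^ v          ≤⟨ ^-monoˡ-≤ v (^-monoˡ-≤ 2 (*-monoˡ-≤ (r ^ suc (u + u)) 2≤r)) ⟩
    ((r ^ E) ^ 2) ^ v    ≡⟨ ^-*-assoc (r ^ E) 2 v ⟩
    (r ^ E) ^ (2 * v)    ≡⟨ ^-*-assoc r E (2 * v) ⟩
    r ^ (E * (2 * v))    ≤⟨ ^-monoʳ-≤ r (exponent-bound q v t (m/n*n≤m t v) 3v≤t) ⟩
    r ^ (8 * t)          ≤⟨ r^8t≤n ⟩
    n                    ∎) m-root
  w²≤m : w ^ 2 ≤ m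
  w²≤m = ≤-floorRoot {v} (≤-trans (≤-reflexive (^-*-assoc w 2 v)) (proj₁ w-root)) m-root
  P*w≤m : P * w ≤ m
  P*w≤m = ^-cancelˡ-≤ 2 (begin
    (P * w) ^ 2    ≡⟨ ^-distribʳ-* P w 2 ⟩
    P ^ 2 * w ^ 2  ≤⟨ *-mono-≤ P²≤m w²≤m ⟩
    m * m          ≡⟨ cong (m *_) (*-identityʳ m) ⟨
    m ^ 2          ∎)
  m^t≤n^[1+q] : m ^ t ≤ n ^ suc q
  m^t≤n^[1+q] = begin
    m ^ t            ≤⟨ ^-monoʳ-≤ m (t≤v*suc[t/v] t v) ⟩
    m ^ (v * suc q)  ≡⟨ ^-*-assoc m v (suc q) ⟨
    (m ^ v) ^ suc q  ≤⟨ ^-monoˡ-≤ (suc q) (proj₁ m-root) ⟩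
    n ^ suc q        ∎
  P*m^t≤n^u : P * m ^ t ≤ n ^ u
  P*m^t≤n^u = *-mono-≤ (≤-trans (≤-trans (m≤m*n P w) P*w≤m) (floorRoot≤ {v} m-root)) m^t≤n^[1+q]

crossing : ∀ (f : ℕ → ℕ) {n} b → f 0 ≤ n → n < f b → ∃[ k ] f k ≤ n × n < f (suc k)
crossing f zero    f0≤n n<f0 = contradiction f0≤n (<⇒≱ n<f0)
crossing f {n} (suc b) f0≤n n<f[1+b] with n <? f b
... | yes n<fb = crossing f b f0≤n n<fb
... | no  n≮fb = b , ≮⇒≥ n≮fb , n<f[1+b]

floorRoot-exists : ∀ v n .{{_ : NonZero v}} → ∃[ w ] IsFloorRoot v n w
floorRoot-exists v@(suc _) n = crossing (_^ v) (suc n) z≤n (begin-strict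
  n               <⟨ n<1+n n ⟩
  suc n           ≡⟨ *-identityʳ (suc n) ⟨
  suc n ^ 1       ≤⟨ ^-monoʳ-≤ (suc n) (>-nonZero⁻¹ v) ⟩
  suc n ^ v       ∎)
  where open ≤-Reasoning

n<r^n : ∀ {r} n → 2 ≤ r → n < r ^ n
n<r^n zero    _   = s≤s z≤n
n<r^n {r} (suc n) 2≤r = begin-strict
  suc n               <⟨ +-monoʳ-< 1 (n<r^n n 2≤r) ⟩
  1 + r ^ n           ≤⟨ +-monoˡ-≤ (r ^ n) (≤-trans (s≤s z≤n) (n<r^n n 2≤r)) ⟩
  r ^ n + r ^ n       ≡⟨ cong (r ^ n +_) (+-identityʳ (r ^ n)) ⟨
  2 * r ^ n           ≤⟨ *-monoˡ-≤ (r ^ n) 2≤r ⟩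
  r ^ suc n           ∎
  where open ≤-Reasoning

floorLog-exists : ∀ {r n} → 2 ≤ r → 0 < n → ∃[ k ] IsFloorLog r n k
floorLog-exists {r} {n} 2≤r n>0 = crossing (r ^_) n n>0 (n<r^n n 2≤r)

floorLog-unique : ∀ {r n} k k′ → 2 ≤ r → IsFloorLog r n k → IsFloorLog r n k′ → k ≡ k′
floorLog-unique {r@(suc _)} k k′ _ (r^k≤n , n<r^[1+k]) (r^k′≤n , n<r^[1+k′]) =
  ≤-antisym (s≤s⁻¹ (^-cancelʳ-< r {k} {suc k′} (≤-<-trans r^k≤n n<r^[1+k′])))
            (s≤s⁻¹ (^-cancelʳ-< r {k′} {suc k} (≤-<-trans r^k′≤n n<r^[1+k])))

⊤-floorRoot : ∀ n → IsFloorRoot 1 n ∣ ⊤ {n} ∣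
⊤-floorRoot n rewrite ∣⊤∣≡n n = ≤-reflexive (*-identityʳ n) , ≤-reflexive (sym (*-identityʳ (suc n)))

floorLog-large : ∀ {r n} y k → 2 ≤ r → r ^ (24 * 2 ^ y) < n → IsFloorLog r n k → 3 * 2 ^ y ≤ k / 8
floorLog-large {r@(suc _)} y k _ r^[24·2^y]<n (_ , n<r^[1+k]) = begin
  3 * 2 ^ y            ≡⟨ m*n/n≡m (3 * 2 ^ y) 8 ⟨
  3 * 2 ^ y * 8 / 8    ≡⟨ cong (_/ 8) (twenty-four (2 ^ y)) ⟩
  24 * 2 ^ y / 8       ≤⟨ /-monoˡ-≤ 8 (s≤s⁻¹ (^-cancelʳ-< r {24 * 2 ^ y} {suc k} (<-trans r^[24·2^y]<n n<r^[1+k]))) ⟩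
  k / 8                ∎
  where
  open ≤-Reasoning
  twenty-four : ∀ x → 3 * x * 8 ≡ 24 * x
  twenty-four = solve-∀

r^[8*[k/8]]≤n : ∀ {r n} k → 2 ≤ r → IsFloorLog r n k → r ^ (8 * (k / 8)) ≤ n
r^[8*[k/8]]≤n {r@(suc _)} k _ (r^k≤n , _) =
  ≤-trans (^-monoʳ-≤ r (≤-trans (≤-reflexive (*-comm 8 (k / 8))) (m/n*n≤m k 8))) r^k≤n

-- Dependent random choice

module DependentRandomChoice {n r : ℕ} (col : Fin n → Fin n → Fin r) (A : Subset n) where

  ∑ᵀ : ∀ s → (Vec (Fin n) s → ℕ) → ℕ
  ∑ᵀ = ∑ⱽ (finSum n)

  private
    module Vertices = Summation (finSum n)
    module Tuples s = Summation (vecSum (finSum n) s)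
    module SubsetsOf = Summation (subsetSum n)
    module Colours = Summation (finSum r)

  deg : Fin r → Fin n → ℕ
  deg c a = sum (λ b → 𝟙 (does (col a b ≟ᶠ c)))

  Rich : Fin r → Pred (Fin n) _
  Rich c a = a ∈ A × n ≤ r * deg c a

  rich? : ∀ c → Decidable (Rich c)
  rich? c a = (a ∈? A) ×-dec (n ≤? r * deg c a)

  #rich : Fin r → ℕ
  #rich c = sum (λ a → 𝟙 (does (rich? c a)))

  ∑deg≡n : ∀ a → Colours.∑ (λ c → deg c a) ≡ n
  ∑deg≡n a = begin
    Colours.∑ (λ c → Vertices.∑ (λ b → 𝟙 (does (col a b ≟ᶠ c)))) ≡⟨ Colours.∑-comm Vertices.isAdditive _ ⟩
    Vertices.∑ (λ b → Colours.∑ (λ c → 𝟙 (does (col a b ≟ᶠ c)))) ≡⟨ Vertices.cong-≗ (λ b → ∑𝟙≟≡1 (col a b)) ⟩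
    Vertices.∑ (λ b → 1)                                         ≡⟨ size-finSum n ⟩
    n                                                            ∎
    where open ≡-Reasoning

  popular-colour : 0 < r → ∃[ c ] ∣ A ∣ ≤ r * #rich c
  popular-colour z<s = fin-pigeonhole #rich (begin
    ∣ A ∣                                                     ≡⟨ ∣p∣≡∑∈ A ⟩
    Vertices.∑ (λ a → 𝟙 (does (a ∈? A)))                      ≤⟨ Vertices.mono some-colour-rich ⟩
    Vertices.∑ (λ a → Colours.∑ (rich a))                     ≡⟨ Vertices.∑-comm Colours.isAdditive rich ⟩
    Colours.∑ #rich                                           ∎)
    where
    open ≤-Reasoning
    rich : Fin n → Fin r → ℕ
    rich a c = 𝟙 (does (rich? c a))
    some-colour-rich : ∀ a → 𝟙 (does (a ∈? A)) ≤ Colours.∑ (rich a)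
    some-colour-rich a = ≤-trans (≤-reflexive (sym (*-identityʳ _))) (𝟙-*-≤ (a ∈? A) λ a∈A →
      let c , n≤r*deg = fin-pigeonhole (λ c → deg c a) (≤-reflexive (sym (∑deg≡n a)))
      in ≤-trans (≤-reflexive (cong 𝟙 (sym (dec-true (rich? c a) (a∈A , n≤r*deg)))))
                 (Colours.term≤∑ (rich a) c))

  W : ∀ {s} → Fin r → Vec (Fin n) s → Subset n
  W c T = tabulate (λ a → does (rich? c a ×-dec all? (λ b → col a b ≟ᶠ c) T))

  W⊆A : ∀ {s} c (T : Vec (Fin n) s) → W c T ⊆ A
  W⊆A c T a∈W = proj₁ (proj₁ (∈-tabulate⁻ (λ a → rich? c a ×-dec all? (λ b → col a b ≟ᶠ c) T) a∈W))

  ∑∣W∣ : ∀ s c → ∑ᵀ s (∣_∣ ∘ W c) ≡ sum (λ a → 𝟙 (does (rich? c a)) * deg c a ^ s)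
  ∑∣W∣ s c = begin
    ∑ᵀ s (λ T → ∣ W c T ∣)
      ≡⟨ Tuples.cong-≗ s (λ T → ∣tabulate∣ (λ a → does (rich? c a) ∧ does (all? (nbr a) T))) ⟩
    ∑ᵀ s (λ T → sum (λ a → 𝟙 (does (rich? c a) ∧ does (all? (nbr a) T))))
      ≡⟨ Summation.∑-comm (finSum n) (Tuples.isAdditive s) _ ⟨
    sum (λ a → ∑ᵀ s (λ T → 𝟙 (does (rich? c a) ∧ does (all? (nbr a) T))))
      ≡⟨ Vertices.cong-≗ (λ a → trans (Tuples.cong-≗ s (λ T → 𝟙-∧ (does (rich? c a)) _))
                                      (Tuples.*-homˡ s (𝟙 (does (rich? c a))) _)) ⟩
    sum (λ a → 𝟙 (does (rich? c a)) * ∑ᵀ s (λ T → 𝟙 (does (all? (nbr a) T))))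
      ≡⟨ Vertices.cong-≗ (λ a → cong (𝟙 (does (rich? c a)) *_) (∑ⱽ-all (finSum n) (nbr a) s)) ⟩
    sum (λ a → 𝟙 (does (rich? c a)) * deg c a ^ s)
      ∎
    where
    open ≡-Reasoning
    nbr : ∀ a → Decidable (λ b → col a b ≡ c)
    nbr a b = col a b ≟ᶠ c

  first-moment : ∀ s c → ∣ A ∣ ≤ r * #rich c → ∣ A ∣ * n ^ s ≤ r ^ suc s * ∑ᵀ s (∣_∣ ∘ W c)
  first-moment s c ∣A∣≤r*#rich = begin
    ∣ A ∣ * n ^ s                                             ≤⟨ *-monoˡ-≤ (n ^ s) ∣A∣≤r*#rich ⟩
    r * #rich c * n ^ s                                       ≡⟨ *-assoc r (#rich c) (n ^ s) ⟩
    r * (#rich c * n ^ s)                                     ≡⟨ cong (r *_) (Vertices.*-homʳ (n ^ s) (𝟙 ∘ rich)) ⟨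
    r * sum (λ a → 𝟙 (rich a) * n ^ s)                        ≤⟨ *-monoʳ-≤ r (Vertices.mono n^s≤r^s*deg^s) ⟩
    r * sum (λ a → r ^ s * (𝟙 (rich a) * deg c a ^ s))        ≡⟨ cong (r *_) (Vertices.*-homˡ (r ^ s) _) ⟩
    r * (r ^ s * sum (λ a → 𝟙 (rich a) * deg c a ^ s))        ≡⟨ *-assoc r (r ^ s) _ ⟨
    r ^ suc s * sum (λ a → 𝟙 (rich a) * deg c a ^ s)          ≡⟨ cong (r ^ suc s *_) (∑∣W∣ s c) ⟨
    r ^ suc s * ∑ᵀ s (∣_∣ ∘ W c)                              ∎
    where
    open ≤-Reasoning
    rich : Fin n → Bool
    rich a = does (rich? c a)
    n^s≤r^s*deg^s : ∀ a → 𝟙 (rich a) * n ^ s ≤ r ^ s * (𝟙 (rich a) * deg c a ^ s)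
    n^s≤r^s*deg^s a = begin
      𝟙 (rich a) * n ^ s               ≤⟨ 𝟙-*-mono (rich? c a) (λ (_ , n≤r*deg) → ^-monoˡ-≤ s n≤r*deg) ⟩
      𝟙 (rich a) * (r * deg c a) ^ s   ≡⟨ cong (𝟙 (rich a) *_) (^-distribʳ-* r (deg c a) s) ⟩
      𝟙 (rich a) * (r ^ s * deg c a ^ s) ≡⟨ x∙yz≈y∙xz (𝟙 (rich a)) (r ^ s) _ ⟩
      r ^ s * (𝟙 (rich a) * deg c a ^ s) ∎

  N : Fin r → Subset n → Subset n
  N c X = commonNbhd col c X

  Bad : Fin r → ℕ → Pred (Subset n) _
  Bad c t X = (X ⊆ A × ∣ X ∣ ≡ t) × ∣ N c X ∣ ^ 2 < n

  bad? : ∀ c t → Decidable (Bad c t)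
  bad? c t X = ((X ⊆? A) ×-dec (∣ X ∣ ≟ t)) ×-dec (∣ N c X ∣ ^ 2 <? n)

  #bad : ∀ {s} → Fin r → ℕ → Vec (Fin n) s → ℕ
  #bad c t T = ∑ₛ n (λ X → 𝟙 (does (bad? c t X)) * 𝟙 (does (all? (_∈? N c X) T)))

  ∑#bad≤ : ∀ u c t → ∑ᵀ (u + u) (#bad c t) ≤ ∣ A ∣ ^ t * n ^ u
  ∑#bad≤ u c t = begin
    ∑ᵀ s (λ T → ∑ₛ n (λ X → 𝟙 (bad X) * 𝟙 (does (all? (_∈? N c X) T))))
      ≡⟨ Summation.∑-comm (vecSum (finSum n) s) (SubsetsOf.isAdditive) _ ⟩
    ∑ₛ n (λ X → ∑ᵀ s (λ T → 𝟙 (bad X) * 𝟙 (does (all? (_∈? N c X) T))))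
      ≡⟨ SubsetsOf.cong-≗ (λ X → trans (Tuples.*-homˡ s (𝟙 (bad X)) _) (cong (𝟙 (bad X) *_) (∑all∈N≡∣N∣^s X))) ⟩
    ∑ₛ n (λ X → 𝟙 (bad X) * ∣ N c X ∣ ^ s)
      ≡⟨ SubsetsOf.cong-≗ (λ X → trans (cong (_* ∣ N c X ∣ ^ s) (𝟙-∧ (sized X) _)) (*-assoc (𝟙 (sized X)) _ _)) ⟩
    ∑ₛ n (λ X → 𝟙 (sized X) * (𝟙 (does (∣ N c X ∣ ^ 2 <? n)) * ∣ N c X ∣ ^ s))
      ≤⟨ SubsetsOf.mono (λ X → *-monoʳ-≤ (𝟙 (sized X)) (𝟙-*-≤ (∣ N c X ∣ ^ 2 <? n) (small⇒∣N∣^s≤ X))) ⟩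
    ∑ₛ n (λ X → 𝟙 (sized X) * n ^ u)
      ≡⟨ SubsetsOf.*-homʳ (n ^ u) (𝟙 ∘ sized) ⟩
    #sized-subsets A t * n ^ u
      ≤⟨ *-monoˡ-≤ (n ^ u) (#sized-subsets≤ A t) ⟩
    ∣ A ∣ ^ t * n ^ u
      ∎
    where
    open ≤-Reasoning
    s = u + u
    bad sized : Subset n → Bool
    bad X = does (bad? c t X)
    sized X = does ((X ⊆? A) ×-dec (∣ X ∣ ≟ t))
    ∑all∈N≡∣N∣^s : ∀ X → ∑ᵀ s (λ T → 𝟙 (does (all? (_∈? N c X) T))) ≡ ∣ N c X ∣ ^ s
    ∑all∈N≡∣N∣^s X = trans (∑ⱽ-all (finSum n) (_∈? N c X) s) (cong (_^ s) (sym (∣p∣≡∑∈ (N c X))))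
    small⇒∣N∣^s≤ : ∀ X → ∣ N c X ∣ ^ 2 < n → ∣ N c X ∣ ^ s ≤ n ^ u
    small⇒∣N∣^s≤ X small = ≤-trans (≤-reflexive (^-+-self ∣ N c X ∣ u)) (^-monoˡ-≤ u (<⇒≤ small))

  W⊆⇒all∈N : ∀ {s} c (T : Vec (Fin n) s) {X} → X ⊆ W c T → All (_∈ N c X) T
  W⊆⇒all∈N c T {X} X⊆W =
    All.map (∈-tabulate⁺ (λ b → allFin? λ a → (a ∈? X) →-dec (col a b ≟ᶠ c)))
            (all-∀ T (λ a a∈X → proj₂ (∈-tabulate⁻ (λ a → rich? c a ×-dec all? (λ b → col a b ≟ᶠ c) T)
                                                   (X⊆W a∈X))))

  -- Counting each bad set ∣ A ∣ times means that a tuple beating the average contains no bad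
  -- set at all, since ∣ W c T ∣ ≤ ∣ A ∣; no deletion step is needed.
  bad-free : ∀ {s c t w} (T : Vec (Fin n) s) → 0 < w → ∣ A ∣ * #bad c t T + w ≤ ∣ W c T ∣ →
             ∀ X → X ⊆ W c T → ∣ X ∣ ≡ t → n ≤ ∣ N c X ∣ ^ 2
  bad-free {s} {c} {t} {w} T w>0 few-bad X X⊆W ∣X∣≡t with n ≤? ∣ N c X ∣ ^ 2
  ... | yes large = large
  ... | no  small = contradiction (begin-strict
    ∣ A ∣                    <⟨ m<m+n ∣ A ∣ w>0 ⟩
    ∣ A ∣ + w                ≤⟨ +-monoˡ-≤ w (m≤m*n ∣ A ∣ (#bad c t T) {{>-nonZero 1≤#bad}}) ⟩
    ∣ A ∣ * #bad c t T + w   ≤⟨ few-bad ⟩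
    ∣ W c T ∣                ≤⟨ p⊆q⇒∣p∣≤∣q∣ (W⊆A c T) ⟩
    ∣ A ∣                    ∎) (<-irrefl refl)
    where
    open ≤-Reasoning
    X-bad : Bad c t X
    X-bad = (W⊆A c T ∘ X⊆W , ∣X∣≡t) , ≰⇒> small
    1≤#bad : 1 ≤ #bad c t T
    1≤#bad = ≤-trans (≤-reflexive (sym (cong₂ (λ x y → 𝟙 x * 𝟙 y) (dec-true (bad? c t X) X-bad)
                                                                  (dec-true (all? (_∈? N c X) T) (W⊆⇒all∈N c T X⊆W)))))
                     (SubsetsOf.term≤∑ (λ X → 𝟙 (does (bad? c t X)) * 𝟙 (does (all? (_∈? N c X) T))) X)

module _ {n r : ℕ} (col : Fin (suc n) → Fin (suc n) → Fin (suc r)) (A : Subset (suc n)) where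
  open DependentRandomChoice col A

  private
    module Tuples s = Summation (vecSum (finSum (suc n)) s)

  #tuples : ∀ s → Tuples.size s ≡ suc n ^ s
  #tuples s = trans (size-vecSum (finSum (suc n)) s) (cong (_^ s) (size-finSum (suc n)))

  few-bad-on-average : ∀ {t u w} c → ∣ A ∣ ≤ suc r * #rich c →
    2 * suc r ^ suc (u + u) * w ≤ ∣ A ∣ → 2 * suc r ^ suc (u + u) * ∣ A ∣ ^ t ≤ suc n ^ u →
    ∑ᵀ (u + u) (λ T → ∣ A ∣ * #bad c t T + w) ≤ ∑ᵀ (u + u) (∣_∣ ∘ W c)
  few-bad-on-average {t} {u} {w} c ∣A∣≤r*#rich 2Rw≤∣A∣ 2R∣A∣^t≤n^u = begin
    ∑ᵀ s (λ T → ∣ A ∣ * #bad c t T + w)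
      ≡⟨ Tuples.+-hom s _ _ ⟩
    ∑ᵀ s (λ T → ∣ A ∣ * #bad c t T) + ∑ᵀ s (λ _ → w)
      ≡⟨ cong₂ _+_ (Tuples.*-homˡ s ∣ A ∣ (#bad c t)) #tuples*w ⟩
    ∣ A ∣ * ∑ᵀ s (#bad c t) + suc n ^ u * suc n ^ u * w
      ≤⟨ drc-inequality ∣ A ∣ _ _ (suc r ^ suc s) (∣ A ∣ ^ t) (suc n ^ u) w (m^n>0 (suc r) (suc s))
                        ∣A∣n^s≤R*∑∣W∣ (∑#bad≤ u c t) 2Rw≤∣A∣ 2R∣A∣^t≤n^u ⟩
    ∑ᵀ s (∣_∣ ∘ W c)
      ∎
    where
    open ≤-Reasoning
    s = u + u
    n^s≡n^u*n^u : suc n ^ s ≡ suc n ^ u * suc n ^ u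
    n^s≡n^u*n^u = ^-distribˡ-+-* (suc n) u u
    #tuples*w : ∑ᵀ s (λ _ → w) ≡ suc n ^ u * suc n ^ u * w
    #tuples*w = trans (Tuples.∑-const s w) (cong (_* w) (trans (#tuples s) n^s≡n^u*n^u))
    ∣A∣n^s≤R*∑∣W∣ : ∣ A ∣ * (suc n ^ u * suc n ^ u) ≤ suc r ^ suc s * ∑ᵀ s (∣_∣ ∘ W c)
    ∣A∣n^s≤R*∑∣W∣ = ≤-trans (≤-reflexive (cong (∣ A ∣ *_) (sym n^s≡n^u*n^u))) (first-moment s c ∣A∣≤r*#rich)

  drc-step : ∀ {t u w} → 0 < w → 2 * suc r ^ suc (u + u) * w ≤ ∣ A ∣ →
             2 * suc r ^ suc (u + u) * ∣ A ∣ ^ t ≤ suc n ^ u →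
             ∃[ c ] ∃[ W ] W ⊆ A × w ≤ ∣ W ∣ ×
               (∀ X → X ⊆ W → ∣ X ∣ ≡ t → suc n ≤ ∣ commonNbhd col c X ∣ ^ 2)
  drc-step {t} {u} {w} w>0 2Rw≤∣A∣ 2R∣A∣^t≤n^u =
    let c , ∣A∣≤r*#rich = popular-colour z<s
        T , few-bad     = Tuples.≤-averaging (u + u) (subst (0 <_) (sym (#tuples (u + u))) (m^n>0 (suc n) (u + u)))
                            (λ T → ∣ A ∣ * #bad c t T + w) (∣_∣ ∘ W c)
                            (few-bad-on-average {t} {u} {w} c ∣A∣≤r*#rich 2Rw≤∣A∣ 2R∣A∣^t≤n^u)
    in c , W c T , W⊆A c T , ≤-trans (m≤n+m w _) few-bad , bad-free T w>0 few-bad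

-- One colouring at a time

module _ {n r t : ℕ} (2≤r : 2 ≤ suc r) (r^8t≤n : suc r ^ (8 * t) ≤ suc n) where

  Good : ∀ {y} → (Fin y → Fin (suc n) → Fin (suc n) → Fin (suc r)) → (Fin y → Fin (suc r)) → Subset (suc n) → Set
  Good χ c W = ∀ i X → X ⊆ W → ∣ X ∣ ≡ t → suc n ≤ ∣ commonNbhd (χ i) (c i) X ∣ ^ 2

  halve : ∀ j (A : Subset (suc n)) → IsFloorRoot (2 ^ j) (suc n) ∣ A ∣ → 3 * 2 ^ j ≤ t →
          (col : Fin (suc n) → Fin (suc n) → Fin (suc r)) →
          ∃[ c ] ∃[ W ] W ⊆ A × IsFloorRoot (2 ^ suc j) (suc n) ∣ W ∣ ×
            (∀ X → X ⊆ W → ∣ X ∣ ≡ t → suc n ≤ ∣ commonNbhd col c X ∣ ^ 2)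
  halve j A A-root 3·2^j≤t col =
    let w , w-root                      = floorRoot-exists (2 ^ suc j) (suc n) {{m^n≢0 2 (suc j)}}
        u , 2Rw≤∣A∣ , 2R∣A∣^t≤n^u         = drc-conditions {v = 2 ^ j} {{m^n≢0 2 j}} z<s 2≤r A-root w-root
                                                         r^8t≤n 3·2^j≤t
        c , W₁ , W₁⊆A , w≤∣W₁∣ , W₁-good = drc-step col A {t} {u} {w} (floorRoot>0 {2 ^ suc j} z<s w-root)
                                                    2Rw≤∣A∣ 2R∣A∣^t≤n^u
        W , W⊆W₁ , ∣W∣≡w                 = ⊆-of-size W₁ w≤∣W₁∣
    in c , W , ⊆-trans W⊆W₁ W₁⊆A , subst (IsFloorRoot (2 ^ suc j) (suc n)) (sym ∣W∣≡w) w-root ,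
       λ X X⊆W → W₁-good X (⊆-trans X⊆W W⊆W₁)

  iterate : ∀ y j (A : Subset (suc n)) → IsFloorRoot (2 ^ j) (suc n) ∣ A ∣ → 3 * 2 ^ (j + y) ≤ t →
            (χ : Fin y → Fin (suc n) → Fin (suc n) → Fin (suc r)) →
            ∃[ W ] ∃[ c ] W ⊆ A × IsFloorRoot (2 ^ (j + y)) (suc n) ∣ W ∣ × Good χ c W
  iterate zero j A A-root _ χ =
    A , (λ ()) , ⊆-refl , subst (λ k → IsFloorRoot (2 ^ k) (suc n) ∣ A ∣) (sym (+-identityʳ j)) A-root , λ ()
  iterate (suc y) j A A-root 3·2^[j+1+y]≤t χ =
    let c₀ , W₁ , W₁⊆A , W₁-root , W₁-good =
          halve j A A-root (≤-trans (*-monoʳ-≤ 3 (^-monoʳ-≤ 2 (m≤m+n j (suc y)))) 3·2^[j+1+y]≤t) (χ zero)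
        W , c , W⊆W₁ , W-root , W-good =
          iterate y (suc j) W₁ W₁-root (subst (λ k → 3 * 2 ^ k ≤ t) (+-suc j y) 3·2^[j+1+y]≤t) (χ ∘ suc)
    in W , c₀ ∷ᶠ c , ⊆-trans W⊆W₁ W₁⊆A ,
       subst (λ k → IsFloorRoot (2 ^ k) (suc n) ∣ W ∣) (sym (+-suc j y)) W-root ,
       λ { zero X X⊆W → W₁-good X (⊆-trans X⊆W W⊆W₁) ; (suc i) → W-good i }

corollary1 : (r y : ℕ) → 2 ≤ r → 1 ≤ y →
  Σ[ N ∈ ℕ ] ((n : ℕ) → N < n → (χ : Fin y → Fin n → Fin n → Fin r) →
    Σ[ W ∈ Subset n ] Σ[ c ∈ (Fin y → Fin r) ] (IsFloorRoot (2 ^ y) n ∣ W ∣ ×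
      ((i : Fin y) (k : ℕ) → IsFloorLog r n k → (X : Subset n) → X ⊆ W →
        ∣ X ∣ ≡ k / 8 → n ≤ ∣ commonNbhd (χ i) (c i) X ∣ ^ 2)))
-- N = r^(24·2^y) makes ⌊k/8⌋ ≥ 3·2^y.
corollary1 (suc r) y 2≤r _ = suc r ^ (24 * 2 ^ y) , λ where
  (suc n) N<n χ →
    let k , k-log                   = floorLog-exists 2≤r z<s
        W , c , _ , W-root , W-good = iterate 2≤r (r^[8*[k/8]]≤n k 2≤r k-log) y 0 ⊤ (⊤-floorRoot (suc n))
                                              (floorLog-large y k 2≤r N<n k-log) χ
    in W , c , W-root , λ i k′ k′-log X X⊆W ∣X∣≡k′/8 →
         W-good i X X⊆W (trans ∣X∣≡k′/8 (cong (_/ 8) (floorLog-unique k′ k 2≤r k′-log k-log)))
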